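{- Let $q$ be a prime power, $0<k<n$ and $0\le t\le k$ integers. If $C,C'\in\mathcal{C}_t(n,k)\setminus\mathcal{I}_t(n,k)$ are equivalent codes, then $C$ and $C'$ belong to the same connected component of $\Lambda_t(n,k)$.
   Context: Let $V=\mathbb{F}_q^n$ with standard basis $e_1,\dots,e_n$. An $[n,m]$-linear code is an $m$-dimensional subspace of $V$; $\mathcal{C}_t(n,m)$ denotes the set of $[n,m]$-codes such that any $t$ columns of a generator matrix (an $m\times n$ matrix whose rows form a basis) are linearly independent. $\Lambda_t(n,k)$ is the graph on $\mathcal{C}_t(n,k)$ with $X\sim Y$ iff $X\cap Y\in\mathcal{C}_t(n,k-1)$. A code $C\in\mathcal{C}_t(n,k)$ is isolated if it contains no subspace in $\mathcal{C}_t(n,k-1)$; $\mathcal{I}_t(n,k)$ is the set of isolated codes. Two codes $X,Y$ are equivalent if $X=\rho(Y)$ for some linear map $\rho$ of $V$ permuting the set $\{\langle e_1\rangle,\dots,\langle e_n\rangle\}$ (a monomial transformation). -}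

module Defs where

open import Level using (_⊔_)
open import Algebra.Bundles using (CommutativeRing)
open import Data.Nat using (ℕ; zero; suc; _∸_)
open import Data.Fin using (Fin; zero; suc)
open import Data.Fin.Permutation using (Permutation′; _⟨$⟩ˡ_)
open import Data.Product using (Σ; ∃; _×_; _,_; proj₁)
open import Function.Definitions using (Injective)
open import Relation.Binary.PropositionalEquality using (_≡_)
open import Relation.Binary.Definitions using (Decidable)
open import Relation.Binary.Construct.Closure.ReflexiveTransitive using (Star)
open import Relation.Nullary using (¬_)

record IsFiniteField {c ℓ} (R : CommutativeRing c ℓ) (q : ℕ) : Set (c ⊔ ℓ) where
  open CommutativeRing R using (Carrier; _≈_; _+_; _*_; 0#; 1#)
  field
    1≉0      : ¬ (1# ≈ 0#)
    inverse  : ∀ x → ¬ (x ≈ 0#) → ∃ λ y → (x * y) ≈ 1#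
    _≟_      : Decidable _≈_
    enum     : Fin q → Carrier
    enum-inj : ∀ i j → enum i ≈ enum j → i ≡ j
    enum-sur : ∀ x → ∃ λ i → enum i ≈ x

module Codes {c ℓ} (R : CommutativeRing c ℓ) where
  open CommutativeRing R using (Carrier; _≈_; _+_; _*_; 0#; 1#)

  Vec : ℕ → Set c
  Vec n = Fin n → Carrier

  Mat : ℕ → ℕ → Set c
  Mat m n = Fin m → Fin n → Carrier

  Σ⟨_⟩ : ∀ {m} → (Fin m → Carrier) → Carrier
  Σ⟨_⟩ {zero}  f = 0#
  Σ⟨_⟩ {suc m} f = f zero + Σ⟨ (λ i → f (suc i)) ⟩

  lincomb : ∀ {m n} → (Fin m → Carrier) → Mat m n → Vec n
  lincomb a G j = Σ⟨ (λ i → a i * G i j) ⟩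

  RowsIndep : ∀ {m n} → Mat m n → Set (c ⊔ ℓ)
  RowsIndep {m} {n} G =
    (a : Fin m → Carrier) → (∀ j → lincomb a G j ≈ 0#) → ∀ i → a i ≈ 0#

  InSpan : ∀ {m n} → Mat m n → Vec n → Set (c ⊔ ℓ)
  InSpan {m} G v = Σ (Fin m → Carrier) λ a → ∀ j → lincomb a G j ≈ v j

  TColsIndep : ∀ {m n} → ℕ → Mat m n → Set (c ⊔ ℓ)
  TColsIndep {m} {n} t G =
    (s : Fin t → Fin n) → Injective _≡_ _≡_ s →
    (b : Fin t → Carrier) →
    (∀ i → Σ⟨ (λ l → b l * G i (s l)) ⟩ ≈ 0#) → ∀ l → b l ≈ 0#

  -- G is a generator matrix of a code in C_t(n,m):
  -- an m-dimensional subspace (rows form a basis) with the t-column property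
  IsGenC : (t n m : ℕ) → Mat m n → Set (c ⊔ ℓ)
  IsGenC t n m G = RowsIndep G × TColsIndep t G

  SameCode : ∀ {m m' n} → Mat m n → Mat m' n → Set (c ⊔ ℓ)
  SameCode {n = n} G H = (v : Vec n) → (InSpan G v → InSpan H v) × (InSpan H v → InSpan G v)

  -- vertices of Λ_t(n,k): codes in C_t(n,k), represented by generator matrices
  Vertex : (t n k : ℕ) → Set (c ⊔ ℓ)
  Vertex t n k = Σ (Mat k n) (IsGenC t n k)

  -- X ~ Y in Λ_t(n,k) iff X ∩ Y ∈ C_t(n,k-1)
  Adjacent : (t n k : ℕ) → Vertex t n k → Vertex t n k → Set (c ⊔ ℓ)
  Adjacent t n k (X , _) (Y , _) =
    Σ (Mat (k ∸ 1) n) λ D → IsGenC t n (k ∸ 1) D ×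
      ((v : Vec n) → (InSpan D v → InSpan X v × InSpan Y v)
                   × (InSpan X v × InSpan Y v → InSpan D v))

  -- X and Y lie in the same connected component of Λ_t(n,k)
  -- (a path from X to a vertex representing the same code as Y)
  SameComponent : (t n k : ℕ) → Vertex t n k → Vertex t n k → Set (c ⊔ ℓ)
  SameComponent t n k X Y =
    Σ (Vertex t n k) λ Z → Star (Adjacent t n k) X Z × SameCode (proj₁ Z) (proj₁ Y)

  Isolated : (t n k : ℕ) → Mat k n → Set (c ⊔ ℓ)
  Isolated t n k C =
    ¬ (Σ (Mat (k ∸ 1) n) λ D → IsGenC t n (k ∸ 1) D × ((v : Vec n) → InSpan D v → InSpan C v))

  -- the monomial map ρ with ρ(e_i) = λ_i e_{σ(i)}, applied to a vector
  monomial : ∀ {n} → Permutation′ n → (Fin n → Carrier) → Vec n → Vec n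
  monomial σ λs v j = λs (σ ⟨$⟩ˡ j) * v (σ ⟨$⟩ˡ j)

  Equivalent : ∀ {m n} → Mat m n → Mat m n → Set (c ⊔ ℓ)
  Equivalent {m} {n} X Y =
    Σ (Permutation′ n) λ σ → Σ (Fin n → Carrier) λ λs →
      (∀ i → ¬ (λs i ≈ 0#)) × SameCode X (λ r → monomial σ λs (Y r))

{-# OPTIONS --safe #-}
module Submission where

-- Call E ∈ C_t(n,k−1) anchored if every vertex of Λ_t(n,k) containing E lies in the
-- component of C'.  Two vertices containing a common E ∈ C_t(n,k−1) are joined through
-- E + ⟨y⟩ for any y outside both (which exists as k < n), so every subcode of C' in
-- C_t(n,k−1) is anchored.  If E₂ ⊆ E₁ + ⟨w⟩ then some vertex contains both E₁ and E₂, so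
-- anchoring passes from E₁ to E₂.  Scaling one column, or swapping two, moves every row of
-- a matrix by a multiple of one fixed vector (e_j, resp. e_a − e_b), so anchoring survives a
-- monomial map applied column by column.  Hence ρ(D) is anchored for D ⊆ C', and C = ρ(C')
-- contains ρ(D).

open import Defs
open import Level using (_⊔_; Setω)
open import Algebra.Bundles using (CommutativeRing)
open import Data.Nat as ℕ using (ℕ; zero; suc; _<_; _≤_; s≤s)
open import Data.Nat.Properties using (m<n⇒m<1+n; ≤-antisym; ≮⇒≥; <⇒≤; ≤-refl)
open import Data.Fin using (Fin; zero; suc; toℕ; fromℕ<; punchIn)
open import Data.Fin.Properties using (≡-setoid; any?; all?; ¬∀⟶∃¬; toℕ<n; toℕ-injective; toℕ-fromℕ<)
import Data.Fin.Properties as Fin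
open import Data.Fin.Permutation as Perm using (Permutation′; _⟨$⟩ˡ_; _⟨$⟩ʳ_)
import Data.Fin.Permutation.Components as PC
open import Data.Fin.Permutation.Transposition.List using (TranspositionList; eval; decompose; eval-decompose)
import Data.List as List
open import Data.Product using (Σ; ∃; _×_; _,_; proj₁; proj₂; swap)
open import Data.Sum using (_⊎_; inj₁; inj₂)
open import Data.Empty using (⊥-elim)
open import Data.Vec.Functional using ([]; _∷_; head; tail; insertAt; removeAt)
open import Data.Vec.Functional.Properties using (insertAt-lookup; insertAt-punchIn)
import Data.Vec.Functional.Relation.Binary.Pointwise.Properties as Pointwise
open import Function using (_∘_; id)
open import Function.Bundles using (Injection)
open import Function.Definitions using (Injective)
open import Function.Properties.Inverse using (↔⇒↣)
open import Relation.Binary.Bundles using (Setoid)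
open import Relation.Binary.Definitions using (_Respects_) renaming (Decidable to Decidable₂)
open import Relation.Binary.Construct.Closure.ReflexiveTransitive using (Star; ε; _◅_; _◅◅_)
open import Relation.Binary.PropositionalEquality as ≡ using (_≡_; _≢_)
open import Relation.Nullary using (¬_; Dec; yes; no)
open import Relation.Nullary.Decidable using (map′; ¬?; _×-dec_; _→-dec_; decidable-stable)
open import Relation.Unary using (Pred; Decidable)

record Searchable {a r} (S : Setoid a r) : Setω where
  constructor mkSearchable
  open Setoid S
  field search : ∀ {p} (P : Pred Carrier p) → P Respects _≈_ → Decidable P → Dec (∃ P)

  search-∀ : ∀ {p} (P : Pred Carrier p) → P Respects _≈_ → Decidable P → Dec (∀ x → P x)
  search-∀ P resp P? =
    map′ (λ ¬∃¬P x → decidable-stable (P? x) (λ ¬Px → ¬∃¬P (x , ¬Px)))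
         (λ ∀P (x , ¬Px) → ¬Px (∀P x))
         (¬? (search (¬_ ∘ P) (λ x≈y ¬Px Py → ¬Px (resp (sym x≈y) Py)) (¬? ∘ P?)))
open Searchable public

fin-searchable : ∀ n → Searchable (≡-setoid n)
fin-searchable n = mkSearchable λ P _ P? → any? P?

vector-searchable : ∀ {a r} {S : Setoid a r} → Searchable S → ∀ m → Searchable (Pointwise.setoid S m)
vector-searchable {S = S} S-searchable m = mkSearchable (go m)
  where
  open Setoid S
  go : ∀ m {p} (P : Pred (Fin m → Carrier) p) → P Respects (λ xs ys → ∀ i → xs i ≈ ys i) →
       Decidable P → Dec (∃ P)
  go zero P resp P? = map′ (λ p → [] , p) (λ (xs , p) → resp {xs} (λ ()) p) (P? [])
  go (suc m) P resp P? =
    map′ (λ (x , xs , p) → x ∷ xs , p)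
         (λ (xs , p) → head xs , tail xs , resp (λ { zero → refl ; (suc i) → refl }) p)
         (search S-searchable (λ x → ∃ λ xs → P (x ∷ xs))
                 (λ x≈y (xs , p) → xs , resp (λ { zero → x≈y ; (suc i) → refl }) p)
                 (λ x → go m (λ xs → P (x ∷ xs))
                          (λ xs≈ys → resp (λ { zero → refl ; (suc i) → xs≈ys i }))
                          (λ xs → P? (x ∷ xs))))

transpose-cases : ∀ {n} (a b j : Fin n) →
  (j ≡ a × PC.transpose a b j ≡ b) ⊎
  (j ≡ b × j ≢ a × PC.transpose a b j ≡ a) ⊎
  (j ≢ a × j ≢ b × PC.transpose a b j ≡ j)
transpose-cases a b j with j Fin.≟ a
... | yes j≡a = inj₁ (j≡a , ≡.refl)
... | no j≢a with j Fin.≟ b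
...   | yes j≡b = inj₂ (inj₁ (j≡b , j≢a , ≡.refl))
...   | no j≢b  = inj₂ (inj₂ (j≢a , j≢b , ≡.refl))

prefixOr : ∀ {a} {A : Set a} {n} → A → ℕ → (Fin n → A) → Fin n → A
prefixOr d m μ j with toℕ j ℕ.<? m
... | yes _ = μ j
... | no _  = d

prefixOr-zero : ∀ {a} {A : Set a} {n} (d : A) (μ : Fin n → A) j → prefixOr d 0 μ j ≡ d
prefixOr-zero d μ j with toℕ j ℕ.<? 0
... | no _ = ≡.refl

prefixOr-all : ∀ {a} {A : Set a} {n} (d : A) (μ : Fin n → A) j → prefixOr d n μ j ≡ μ j
prefixOr-all {n = n} d μ j with toℕ j ℕ.<? n
... | yes _   = ≡.refl
... | no j≮n = ⊥-elim (j≮n (toℕ<n j))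

prefixOr-suc : ∀ {a} {A : Set a} {n} (d : A) {m} (m<n : m < n) (μ : Fin n → A) {j} → j ≢ fromℕ< m<n →
               prefixOr d (suc m) μ j ≡ prefixOr d m μ j
prefixOr-suc d {m} m<n μ {j} j≢m with toℕ j ℕ.<? suc m | toℕ j ℕ.<? m
... | yes _         | yes _   = ≡.refl
... | no _          | no _    = ≡.refl
... | no j≮1+m      | yes j<m = ⊥-elim (j≮1+m (m<n⇒m<1+n j<m))
... | yes (s≤s j≤m) | no j≮m  =
  ⊥-elim (j≢m (toℕ-injective (≡.trans (≤-antisym j≤m (≮⇒≥ j≮m)) (≡.sym (toℕ-fromℕ< m<n)))))

prefixOr-preserves : ∀ {a p} {A : Set a} {n} (P : A → Set p) {d : A} {μ : Fin n → A} →
                     P d → (∀ j → P (μ j)) → ∀ m j → P (prefixOr d m μ j)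
prefixOr-preserves P Pd Pμ m j with toℕ j ℕ.<? m
... | yes _ = Pμ j
... | no _  = Pd

module RowSpaces {c ℓ} (R : CommutativeRing c ℓ) where
  open CommutativeRing R hiding (zero)
  open Codes R
  open import Relation.Binary.Reasoning.Setoid setoid
  open import Algebra.Properties.Ring ring using (-1*x≈-x; -‿distribʳ-*)
  open import Algebra.Properties.AbelianGroup +-abelianGroup using (⁻¹-anti-homo‿-; //-rightDividesˡ; ε⁻¹≈ε)
  open import Algebra.Properties.CommutativeSemigroup +-commutativeSemigroup using (interchange)
  open import Algebra.Properties.CommutativeSemigroup *-commutativeSemigroup using (x∙yz≈y∙xz)

  Σ-cong : ∀ {m} {f g : Fin m → Carrier} → (∀ i → f i ≈ g i) → Σ⟨ f ⟩ ≈ Σ⟨ g ⟩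
  Σ-cong {zero}  f≈g = refl
  Σ-cong {suc m} f≈g = +-cong (f≈g zero) (Σ-cong (f≈g ∘ suc))

  Σ-zero : ∀ {m} (f : Fin m → Carrier) → (∀ i → f i ≈ 0#) → Σ⟨ f ⟩ ≈ 0#
  Σ-zero {zero}  f f≈0 = refl
  Σ-zero {suc m} f f≈0 = trans (+-cong (f≈0 zero) (Σ-zero (f ∘ suc) (f≈0 ∘ suc))) (+-identityʳ 0#)

  Σ-distrib-+ : ∀ {m} (f g : Fin m → Carrier) → Σ⟨ (λ i → f i + g i) ⟩ ≈ Σ⟨ f ⟩ + Σ⟨ g ⟩
  Σ-distrib-+ {zero}  f g = sym (+-identityʳ 0#)
  Σ-distrib-+ {suc m} f g = trans (+-cong refl (Σ-distrib-+ (f ∘ suc) (g ∘ suc))) (interchange _ _ _ _)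

  *-distribˡ-Σ : ∀ {m} x (f : Fin m → Carrier) → x * Σ⟨ f ⟩ ≈ Σ⟨ (λ i → x * f i) ⟩
  *-distribˡ-Σ {zero}  x f = zeroʳ x
  *-distribˡ-Σ {suc m} x f = trans (distribˡ x _ _) (+-cong refl (*-distribˡ-Σ x (f ∘ suc)))

  δ : ∀ {m} → Fin m → Vec m
  δ zero    zero    = 1#
  δ zero    (suc i) = 0#
  δ (suc r) zero    = 0#
  δ (suc r) (suc i) = δ r i

  δ-diag : ∀ {m} (r : Fin m) → δ r r ≡ 1#
  δ-diag zero    = ≡.refl
  δ-diag (suc r) = δ-diag r

  δ-offdiag : ∀ {m} {r i : Fin m} → r ≢ i → δ r i ≡ 0#
  δ-offdiag {r = zero}  {zero}  r≢i = ⊥-elim (r≢i ≡.refl)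
  δ-offdiag {r = zero}  {suc i} r≢i = ≡.refl
  δ-offdiag {r = suc r} {zero}  r≢i = ≡.refl
  δ-offdiag {r = suc r} {suc i} r≢i = δ-offdiag (r≢i ∘ ≡.cong suc)

  Σ-δ : ∀ {m} (r : Fin m) (f : Fin m → Carrier) → Σ⟨ (λ i → δ r i * f i) ⟩ ≈ f r
  Σ-δ zero    f = trans (+-cong (*-identityˡ _) (Σ-zero _ (λ i → zeroˡ (f (suc i))))) (+-identityʳ _)
  Σ-δ (suc r) f = trans (+-cong (zeroˡ _) (Σ-δ r (f ∘ suc))) (+-identityˡ _)

  lincomb-cong : ∀ {m n} {a b : Fin m → Carrier} {G H : Mat m n} →
                 (∀ i → a i ≈ b i) → (∀ i j → G i j ≈ H i j) → ∀ j → lincomb a G j ≈ lincomb b H j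
  lincomb-cong a≈b G≈H j = Σ-cong (λ i → *-cong (a≈b i) (G≈H i j))

  module _ {m n} (G : Mat m n) where
    span-cong : ∀ {u v} → InSpan G u → (∀ j → u j ≈ v j) → InSpan G v
    span-cong (a , h) u≈v = a , λ j → trans (h j) (u≈v j)

    span-0 : InSpan G (λ _ → 0#)
    span-0 = (λ _ → 0#) , λ j → Σ-zero _ (λ i → zeroˡ (G i j))

    span-row : ∀ r → InSpan G (G r)
    span-row r = δ r , λ j → Σ-δ r (λ i → G i j)

    span-+ : ∀ {u v} → InSpan G u → InSpan G v → InSpan G (λ j → u j + v j)
    span-+ (a , ha) (b , hb) = (λ i → a i + b i) , λ j →
      trans (Σ-cong (λ i → distribʳ (G i j) (a i) (b i)))
            (trans (Σ-distrib-+ (λ i → a i * G i j) (λ i → b i * G i j)) (+-cong (ha j) (hb j)))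

    span-* : ∀ x {v} → InSpan G v → InSpan G (λ j → x * v j)
    span-* x (a , h) = (λ i → x * a i) , λ j →
      trans (Σ-cong (λ i → *-assoc x (a i) (G i j)))
            (trans (sym (*-distribˡ-Σ x (λ i → a i * G i j))) (*-cong refl (h j)))

    span-- : ∀ {u v} → InSpan G u → InSpan G v → InSpan G (λ j → u j - v j)
    span-- u∈ v∈ = span-+ u∈ (span-cong (span-* (- 1#) v∈) (λ j → -1*x≈-x _))

    span-lincomb : ∀ {k} (a : Fin k → Carrier) (A : Mat k n) → (∀ r → InSpan G (A r)) → InSpan G (lincomb a A)
    span-lincomb {zero}  a A rows = span-0
    span-lincomb {suc k} a A rows =
      span-+ (span-* (a zero) (rows zero)) (span-lincomb (a ∘ suc) (A ∘ suc) (rows ∘ suc))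

  infix 4 _⊆_
  record _⊆_ {m m' n} (A : Mat m n) (B : Mat m' n) : Set (c ⊔ ℓ) where
    constructor mk⊆
    field ⊆⇒span : ∀ {v} → InSpan A v → InSpan B v
  open _⊆_ public

  ⊆-trans : ∀ {m m' m'' n} {A : Mat m n} {B : Mat m' n} {C : Mat m'' n} → A ⊆ B → B ⊆ C → A ⊆ C
  ⊆-trans A⊆B B⊆C = mk⊆ (⊆⇒span B⊆C ∘ ⊆⇒span A⊆B)

  ⊆⇒rows : ∀ {m m' n} {A : Mat m n} {B : Mat m' n} → A ⊆ B → ∀ r → InSpan B (A r)
  ⊆⇒rows {A = A} A⊆B r = ⊆⇒span A⊆B (span-row A r)

  rows⇒⊆ : ∀ {m m' n} {A : Mat m n} {B : Mat m' n} → (∀ r → InSpan B (A r)) → A ⊆ B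
  rows⇒⊆ {A = A} {B} rows = mk⊆ λ (a , h) → span-cong B (span-lincomb B a A rows) h

  ⊆-∷ : ∀ {m n} {y : Vec n} {D : Mat m n} → D ⊆ y ∷ D
  ⊆-∷ {y = y} {D} = rows⇒⊆ (span-row (y ∷ D) ∘ suc)

  ∷-⊆ : ∀ {m m' n} {y : Vec n} {D : Mat m n} {B : Mat m' n} → InSpan B y → D ⊆ B → y ∷ D ⊆ B
  ∷-⊆ y∈B D⊆B = rows⇒⊆ λ { zero → y∈B ; (suc r) → ⊆⇒rows D⊆B r }

  adjacent-sym : ∀ {t n k} {X Y : Vertex t n k} → Adjacent t n k X Y → Adjacent t n k Y X
  adjacent-sym (D , D-gen , D≡X∩Y) = D , D-gen , λ v →
    (swap ∘ proj₁ (D≡X∩Y v)) , (proj₂ (D≡X∩Y v) ∘ swap)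

  RowsIndep-cong : ∀ {m n} {A B : Mat m n} → RowsIndep A → (∀ i j → A i j ≈ B i j) → RowsIndep B
  RowsIndep-cong indep A≈B a comb≈0 = indep a (λ j → trans (lincomb-cong (λ _ → refl) A≈B j) (comb≈0 j))

  IsGenC-cong : ∀ {t n m} {A B : Mat m n} → IsGenC t n m A → (∀ i j → A i j ≈ B i j) → IsGenC t n m B
  IsGenC-cong (rows , cols) A≈B =
    RowsIndep-cong rows A≈B , λ s s-inj → RowsIndep-cong (cols s s-inj) (λ l i → A≈B i (s l))

  IsGenC-permute : ∀ {t n m} {E : Mat m n} → IsGenC t n m E → (π : Permutation′ n) →
                   IsGenC t n m (λ r j → E r (π ⟨$⟩ʳ j))
  IsGenC-permute {E = E} (rows , cols) π =
    (λ a comb≈0 → rows a (λ j → ≡.subst (λ j' → lincomb a E j' ≈ 0#) (Perm.inverseʳ π) (comb≈0 (π ⟨$⟩ˡ j)))) ,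
    (λ s s-inj → cols ((π ⟨$⟩ʳ_) ∘ s) (s-inj ∘ Injection.injective (↔⇒↣ π)))

  x+[y-x]≈y : ∀ x y → x + (y - x) ≈ y
  x+[y-x]≈y x y = trans (+-comm x (y - x)) (//-rightDividesˡ x y)

  x+d≈y : ∀ {x y d} → d ≈ y - x → x + d ≈ y
  x+d≈y {x} {y} d≈y-x = trans (+-congˡ d≈y-x) (x+[y-x]≈y x y)

  ⊆-∷-shift : ∀ {m n} {w : Vec n} {E₁ E₂ : Mat m n} →
              (∀ r → ∃ λ x → ∀ j → E₂ r j ≈ E₁ r j + x * w j) → E₂ ⊆ w ∷ E₁
  ⊆-∷-shift {w = w} {E₁} shift = rows⇒⊆ λ r →
    span-cong W (span-+ W (span-row W (suc r)) (span-* W (proj₁ (shift r)) (span-row W zero)))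
              (λ j → sym (proj₂ (shift r) j))
    where W = w ∷ E₁

  ⊆-∷-δ : ∀ {m n} {E₁ E₂ : Mat m n} (j₀ : Fin n) → (∀ r j → j ≢ j₀ → E₂ r j ≈ E₁ r j) → E₂ ⊆ δ j₀ ∷ E₁
  ⊆-∷-δ {E₁ = E₁} {E₂} j₀ agree = ⊆-∷-shift λ r → E₂ r j₀ - E₁ r j₀ , shifted r
    where
    shifted : ∀ r j → E₂ r j ≈ E₁ r j + (E₂ r j₀ - E₁ r j₀) * δ j₀ j
    shifted r j with j Fin.≟ j₀
    ... | yes ≡.refl rewrite δ-diag j₀ = sym (x+d≈y (*-identityʳ _))
    ... | no j≢j₀ rewrite δ-offdiag (j≢j₀ ∘ ≡.sym) =
      trans (agree r j j≢j₀) (sym (trans (+-congˡ (zeroʳ _)) (+-identityʳ _)))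

  transpose-shift : ∀ {n} (v : Vec n) (a b j : Fin n) →
                    v (PC.transpose a b j) ≈ v j + (v b - v a) * (δ a j - δ b j)
  transpose-shift v a b j with transpose-cases a b j
  ... | inj₁ (≡.refl , τj≡b) rewrite τj≡b with b Fin.≟ j
  ...   | yes ≡.refl = sym (x+d≈y (trans (*-congʳ (-‿inverseʳ (v j))) (trans (zeroˡ _) (sym (-‿inverseʳ (v j))))))
  ...   | no b≢j rewrite δ-diag j | δ-offdiag b≢j = sym (x+d≈y (begin
    (v b - v j) * (1# - 0#)  ≈⟨ *-congˡ (trans (+-congˡ ε⁻¹≈ε) (+-identityʳ 1#)) ⟩
    (v b - v j) * 1#         ≈⟨ *-identityʳ _ ⟩
    v b - v j                ∎))
  transpose-shift v a b j | inj₂ (inj₁ (≡.refl , j≢a , τj≡a)) rewrite τj≡a | δ-offdiag (j≢a ∘ ≡.sym) | δ-diag j =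
    sym (x+d≈y (begin
    (v j - v a) * (0# - 1#)  ≈⟨ *-congˡ (+-identityˡ _) ⟩
    (v j - v a) * - 1#       ≈⟨ sym (-‿distribʳ-* _ _) ⟩
    - ((v j - v a) * 1#)     ≈⟨ -‿cong (*-identityʳ _) ⟩
    - (v j - v a)            ≈⟨ ⁻¹-anti-homo‿- _ _ ⟩
    v a - v j                ∎))
  transpose-shift v a b j | inj₂ (inj₂ (j≢a , j≢b , τj≡j))
    rewrite τj≡j | δ-offdiag (j≢a ∘ ≡.sym) | δ-offdiag (j≢b ∘ ≡.sym) =
    sym (x+d≈y (trans (*-congˡ (-‿inverseʳ 0#)) (trans (zeroʳ _) (sym (-‿inverseʳ (v j))))))

  ⊆-∷-transpose : ∀ {m n} (E : Mat m n) (a b : Fin n) →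
                  (λ r j → E r (PC.transpose a b j)) ⊆ (λ j → δ a j - δ b j) ∷ E
  ⊆-∷-transpose E a b = ⊆-∷-shift λ r → E r b - E r a , transpose-shift (E r) a b

  clearColumn : ∀ {k n} → Mat (suc k) n → Fin n → Carrier → Mat k n
  clearColumn A j₀ z i j = A (suc i) j - (A (suc i) j₀ * z) * A zero j

  clearColumn-vanishes : ∀ {k n} (A : Mat (suc k) n) (j₀ : Fin n) {z} → A zero j₀ * z ≈ 1# →
                         ∀ i → clearColumn A j₀ z i j₀ ≈ 0#
  clearColumn-vanishes A j₀ {z} pivot*z≈1 i = begin
    x - (x * z) * p  ≈⟨ +-congˡ (-‿cong (*-assoc x z p)) ⟩
    x - x * (z * p)  ≈⟨ +-congˡ (-‿cong (*-congˡ (trans (*-comm z p) pivot*z≈1))) ⟩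
    x - x * 1#       ≈⟨ +-congˡ (-‿cong (*-identityʳ x)) ⟩
    x - x            ≈⟨ -‿inverseʳ x ⟩
    0#               ∎
    where x = A (suc i) j₀
          p = A zero j₀

  ⊆-∷-clearColumn : ∀ {k n} (A : Mat (suc k) n) (j₀ : Fin n) (z : Carrier) → A ⊆ A zero ∷ clearColumn A j₀ z
  ⊆-∷-clearColumn A j₀ z = rows⇒⊆ λ
    { zero    → span-row (A zero ∷ clearColumn A j₀ z) zero
    ; (suc i) → ⊆⇒rows (⊆-∷-shift {E₂ = A ∘ suc} λ r → A (suc r) j₀ * z , λ j → sym (//-rightDividesˡ _ _)) i
    }

  span-removeAt : ∀ {m n} (G : Mat m (suc n)) (j₀ : Fin (suc n)) {v} →
                  InSpan G v → InSpan (λ i → removeAt (G i) j₀) (removeAt v j₀)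
  span-removeAt G j₀ (a , h) = a , h ∘ punchIn j₀

  span-monomial : ∀ {m n} (σ : Permutation′ n) (λs : Fin n → Carrier) (B : Mat m n) {v} →
                  InSpan B v → InSpan (λ r → monomial σ λs (B r)) (monomial σ λs v)
  span-monomial σ λs B (a , h) = a , λ j →
    trans (Σ-cong (λ i → x∙yz≈y∙xz (a i) _ _))
          (trans (sym (*-distribˡ-Σ _ (λ i → a i * B i (σ ⟨$⟩ˡ j)))) (*-cong refl (h (σ ⟨$⟩ˡ j))))

  ⊆-monomial : ∀ {m m' n} (σ : Permutation′ n) (λs : Fin n → Carrier) {A : Mat m n} {B : Mat m' n} →
               A ⊆ B → (λ r → monomial σ λs (A r)) ⊆ (λ r → monomial σ λs (B r))
  ⊆-monomial σ λs {B = B} A⊆B = rows⇒⊆ (span-monomial σ λs B ∘ ⊆⇒rows A⊆B)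

record IsDiscreteField {c ℓ} (R : CommutativeRing c ℓ) : Set (c ⊔ ℓ) where
  open CommutativeRing R using (_≈_; _*_; 0#; 1#)
  field
    1≉0     : ¬ 1# ≈ 0#
    inverse : ∀ x → ¬ x ≈ 0# → ∃ λ y → x * y ≈ 1#
    _≟_     : Decidable₂ _≈_

module Elimination {c ℓ} {R : CommutativeRing c ℓ} (K : IsDiscreteField R) where
  open CommutativeRing R hiding (zero)
  open IsDiscreteField K
  open Codes R
  open RowSpaces R
  open import Algebra.Properties.AbelianGroup +-abelianGroup using (x≈z//y)
  open import Algebra.Properties.CommutativeSemigroup *-commutativeSemigroup using (x∙yz≈y∙xz)
  open import Relation.Binary.Reasoning.Setoid setoid

  x≉0∧x*y≈0⇒y≈0 : ∀ {x y} → ¬ x ≈ 0# → x * y ≈ 0# → y ≈ 0#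
  x≉0∧x*y≈0⇒y≈0 {x} {y} x≉0 xy≈0 = let z , x*z≈1 = inverse x x≉0 in begin
    y              ≈⟨ sym (*-identityˡ y) ⟩
    1# * y         ≈⟨ *-congʳ (trans (sym x*z≈1) (*-comm x z)) ⟩
    (z * x) * y    ≈⟨ *-assoc z x y ⟩
    z * (x * y)    ≈⟨ *-congˡ xy≈0 ⟩
    z * 0#         ≈⟨ zeroʳ z ⟩
    0#             ∎

  x≉0∧y*x≈0⇒y≈0 : ∀ {x y} → ¬ x ≈ 0# → y * x ≈ 0# → y ≈ 0#
  x≉0∧y*x≈0⇒y≈0 x≉0 yx≈0 = x≉0∧x*y≈0⇒y≈0 x≉0 (trans (*-comm _ _) yx≈0)

  lincomb-∷ : ∀ {m n} {a : Fin (suc m) → Carrier} {y : Vec n} {D : Mat m n} →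
              a zero ≈ 0# → ∀ j → lincomb a (y ∷ D) j ≈ lincomb (tail a) D j
  lincomb-∷ a₀≈0 j = trans (+-congʳ (trans (*-congʳ a₀≈0) (zeroˡ _))) (+-identityˡ _)

  span-exchange : ∀ {m m' n} {a : Fin (suc m) → Carrier} {y v : Vec n} {D : Mat m n} {B : Mat m' n} →
                  (∀ j → lincomb a (y ∷ D) j ≈ v j) → ¬ a zero ≈ 0# → D ⊆ B → InSpan B v → InSpan B y
  span-exchange {a = a} {y} {v} {D} {B} comb≈v a₀≉0 D⊆B v∈B =
    span-cong B (span-* B z (span-- B v∈B (⊆⇒span D⊆B (tail a , λ j → refl)))) y≈
    where
    z = proj₁ (inverse (a zero) a₀≉0)
    y≈ : ∀ j → z * (v j - lincomb (tail a) D j) ≈ y j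
    y≈ j = begin
      z * (v j - lincomb (tail a) D j) ≈⟨ *-congˡ (sym (x≈z//y _ _ _ (comb≈v j))) ⟩
      z * (a zero * y j)               ≈⟨ x∙yz≈y∙xz z (a zero) (y j) ⟩
      a zero * (z * y j)               ≈⟨ sym (*-assoc _ _ _) ⟩
      (a zero * z) * y j               ≈⟨ *-congʳ (proj₂ (inverse (a zero) a₀≉0)) ⟩
      1# * y j                         ≈⟨ *-identityˡ (y j) ⟩
      y j                              ∎

  span-∷ : ∀ {m m' n} {y v : Vec n} {D : Mat m n} {B : Mat m' n} →
           D ⊆ B → ¬ InSpan B y → InSpan B v → InSpan (y ∷ D) v → InSpan D v
  span-∷ {y = y} {D = D} D⊆B y∉B v∈B (a , comb≈v) with a zero ≟ 0#
  ... | yes a₀≈0 = tail a , λ j → trans (sym (lincomb-∷ {a = a} {y} {D} a₀≈0 j)) (comb≈v j)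
  ... | no a₀≉0  = ⊥-elim (y∉B (span-exchange {a = a} comb≈v a₀≉0 D⊆B v∈B))

  ∷-RowsIndep : ∀ {m n} {y : Vec n} {D : Mat m n} → RowsIndep D → ¬ InSpan D y → RowsIndep (y ∷ D)
  ∷-RowsIndep {y = y} {D} D-indep y∉D a comb≈0 with a zero ≟ 0#
  ... | yes a₀≈0 = λ
    { zero    → a₀≈0
    ; (suc i) → D-indep (tail a) (λ j → trans (sym (lincomb-∷ {a = a} {y} {D} a₀≈0 j)) (comb≈0 j)) i
    }
  ... | no a₀≉0  = ⊥-elim (y∉D (span-exchange {a = a} comb≈0 a₀≉0 (mk⊆ id) (span-0 D)))

  ∷-IsGenC : ∀ {t n m} {y : Vec n} {D : Mat m n} → IsGenC t n m D → ¬ InSpan D y → IsGenC t n (suc m) (y ∷ D)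
  ∷-IsGenC (rows , cols) y∉D = ∷-RowsIndep rows y∉D , λ s s-inj b comb≈0 → cols s s-inj b (comb≈0 ∘ suc)

  adjacent-∷ : ∀ {t n k} {D : Mat k n} {y : Vec n} (X : Vertex t n (suc k)) →
               IsGenC t n k D → D ⊆ proj₁ X → ¬ InSpan (proj₁ X) y →
               (yD-gen : IsGenC t n (suc k) (y ∷ D)) → Adjacent t n (suc k) X (y ∷ D , yD-gen)
  adjacent-∷ X D-gen D⊆X y∉X _ = _ , D-gen , λ v →
    (λ v∈D → ⊆⇒span D⊆X v∈D , ⊆⇒span ⊆-∷ v∈D) , λ (v∈X , v∈yD) → span-∷ D⊆X y∉X v∈X v∈yD

  RowsIndep-scaleColumns : ∀ {m n} {E : Mat m n} {μ : Fin n → Carrier} → (∀ j → ¬ μ j ≈ 0#) →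
                           RowsIndep E → RowsIndep (λ r j → μ j * E r j)
  RowsIndep-scaleColumns {E = E} {μ} μ≉0 indep a comb≈0 = indep a λ j → x≉0∧x*y≈0⇒y≈0 (μ≉0 j) (begin
    μ j * lincomb a E j               ≈⟨ *-distribˡ-Σ (μ j) (λ i → a i * E i j) ⟩
    Σ⟨ (λ i → μ j * (a i * E i j)) ⟩  ≈⟨ Σ-cong (λ i → x∙yz≈y∙xz (μ j) (a i) (E i j)) ⟩
    Σ⟨ (λ i → a i * (μ j * E i j)) ⟩  ≈⟨ comb≈0 j ⟩
    0#                                ∎)

  RowsIndep-scaleRows : ∀ {m n} {E : Mat m n} {ν : Fin m → Carrier} → (∀ r → ¬ ν r ≈ 0#) →
                        RowsIndep E → RowsIndep (λ r j → ν r * E r j)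
  RowsIndep-scaleRows {E = E} {ν = ν} ν≉0 indep a comb≈0 r =
    x≉0∧y*x≈0⇒y≈0 (ν≉0 r)
      (indep (λ i → a i * ν i) (λ j → trans (Σ-cong (λ i → *-assoc (a i) (ν i) (E i j))) (comb≈0 j)) r)

  IsGenC-scale : ∀ {t n m} {E : Mat m n} {μ : Fin n → Carrier} → (∀ j → ¬ μ j ≈ 0#) →
                 IsGenC t n m E → IsGenC t n m (λ r j → μ j * E r j)
  IsGenC-scale μ≉0 (rows , cols) =
    RowsIndep-scaleColumns μ≉0 rows , λ s s-inj → RowsIndep-scaleRows (μ≉0 ∘ s) (cols s s-inj)

  span-∷-vanishing : ∀ {m n} {r v : Vec n} {D : Mat m n} (j₀ : Fin n) → ¬ r j₀ ≈ 0# →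
                     (∀ i → D i j₀ ≈ 0#) → v j₀ ≈ 0# → InSpan (r ∷ D) v → InSpan D v
  span-∷-vanishing {r = r} {v} {D} j₀ r≉0 D≈0 v≈0 (a , comb≈v) =
    tail a , λ j → trans (sym (lincomb-∷ {a = a} {r} {D} a₀≈0 j)) (comb≈v j)
    where
    a₀≈0 : a zero ≈ 0#
    a₀≈0 = x≉0∧y*x≈0⇒y≈0 r≉0 (begin
      a zero * r j₀                          ≈⟨ sym (+-identityʳ _) ⟩
      a zero * r j₀ + 0#                     ≈⟨ +-congˡ (sym (Σ-zero _ (λ i → trans (*-congˡ (D≈0 i)) (zeroʳ (a (suc i)))))) ⟩
      lincomb a (r ∷ D) j₀                   ≈⟨ comb≈v j₀ ⟩
      v j₀                                   ≈⟨ v≈0 ⟩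
      0#                                     ∎)

  zero-row-⊆-tail : ∀ {k n} (A : Mat (suc k) n) → (∀ j → A zero j ≈ 0#) → A ⊆ tail A
  zero-row-⊆-tail A row₀≈0 = rows⇒⊆ λ
    { zero    → span-cong (tail A) (span-0 (tail A)) (sym ∘ row₀≈0)
    ; (suc i) → span-row (tail A) i
    }

  span-eliminate : ∀ {k n} (A : Mat (suc k) (suc n)) (j₀ : Fin (suc n)) {z} → A zero j₀ * z ≈ 1# →
                   ∀ y' → InSpan A (insertAt y' j₀ 0#) → InSpan (λ i → removeAt (clearColumn A j₀ z i) j₀) y'
  span-eliminate A j₀ {z} pivot*z≈1 y' y∈A =
    span-cong _ (span-removeAt (clearColumn A j₀ z) j₀
                  (span-∷-vanishing j₀ pivot≉0 (clearColumn-vanishes A j₀ pivot*z≈1)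
                     (reflexive (insertAt-lookup y' j₀ 0#)) (⊆⇒span (⊆-∷-clearColumn A j₀ z) y∈A)))
              (reflexive ∘ insertAt-punchIn y' j₀ 0#)
    where
    pivot≉0 : ¬ A zero j₀ ≈ 0#
    pivot≉0 pivot≈0 = 1≉0 (trans (sym pivot*z≈1) (trans (*-congʳ pivot≈0) (zeroˡ z)))

  ∃-∉-span : ∀ {k n} → k < n → (A : Mat k n) → ∃ λ y → ¬ InSpan A y
  ∃-∉-span {zero}  {suc n} _ A = (λ _ → 1#) , λ (a , comb≈1) → 1≉0 (sym (comb≈1 zero))
  ∃-∉-span {suc k} {suc n} (s≤s k<n) A with all? (λ j → A zero j ≟ 0#)
  ... | yes row₀≈0 =
    let y , y∉ = ∃-∉-span (m<n⇒m<1+n k<n) (tail A) in y , y∉ ∘ ⊆⇒span (zero-row-⊆-tail A row₀≈0)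
  ... | no row₀≉0 with ¬∀⟶∃¬ _ _ (λ j → A zero j ≟ 0#) row₀≉0
  ...   | j₀ , pivot≉0 =
    let z , pivot*z≈1 = inverse (A zero j₀) pivot≉0
        y' , y'∉ = ∃-∉-span k<n (λ i → removeAt (clearColumn A j₀ z i) j₀)
    in insertAt y' j₀ 0# , y'∉ ∘ span-eliminate A j₀ pivot*z≈1 y'

module FiniteFieldCodes {c ℓ} (R : CommutativeRing c ℓ) {q} (F : IsFiniteField R q) where
  open CommutativeRing R hiding (zero)
  open Codes R
  open IsFiniteField F
  open RowSpaces R

  isDiscreteField : IsDiscreteField R
  isDiscreteField = record { 1≉0 = 1≉0 ; inverse = inverse ; _≟_ = _≟_ }

  open Elimination isDiscreteField
  open import Algebra.Properties.AbelianGroup +-abelianGroup using (//-rightDividesʳ)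

  carrier-searchable : Searchable setoid
  carrier-searchable = mkSearchable λ P resp P? →
    map′ (λ (i , p) → enum i , p)
         (λ (x , p) → proj₁ (enum-sur x) , resp (sym (proj₂ (enum-sur x))) p)
         (any? (P? ∘ enum))

  vectors-searchable : ∀ {n} → Searchable (Pointwise.setoid setoid n)
  vectors-searchable = vector-searchable carrier-searchable _

  matrices-searchable : ∀ {m n} → Searchable (Pointwise.setoid (Pointwise.setoid setoid n) m)
  matrices-searchable = vector-searchable vectors-searchable _

  selections-searchable : ∀ {t n} → Searchable (Pointwise.setoid (≡-setoid n) t)
  selections-searchable = vector-searchable (fin-searchable _) _

  span? : ∀ {m n} (G : Mat m n) → Decidable (InSpan G)
  span? G v = search vectors-searchable _
    (λ a≈b comb≈v j → trans (lincomb-cong {G = G} {G} (sym ∘ a≈b) (λ _ _ → refl) j) (comb≈v j))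
    (λ a → all? (λ j → lincomb a G j ≟ v j))

  RowsIndep? : ∀ {m n} (G : Mat m n) → Dec (RowsIndep G)
  RowsIndep? G = search-∀ vectors-searchable _
    (λ a≈b indep comb≈0 i →
       trans (sym (a≈b i)) (indep (λ j → trans (lincomb-cong {G = G} {G} a≈b (λ _ _ → refl) j) (comb≈0 j)) i))
    (λ a → all? (λ j → lincomb a G j ≟ 0#) →-dec all? (λ i → a i ≟ 0#))

  injective? : ∀ {t n} (s : Fin t → Fin n) → Dec (Injective _≡_ _≡_ s)
  injective? s = map′ (λ inj {x} {y} → inj x y) (λ inj x y → inj)
                      (all? λ x → all? λ y → s x Fin.≟ s y →-dec x Fin.≟ y)

  -- TColsIndep t G unfolds to: for every injective s, the columns selected by s, read as
  -- rows, are independent.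
  TColsIndep? : ∀ t {m n} (G : Mat m n) → Dec (TColsIndep t G)
  TColsIndep? t G = search-∀ selections-searchable _
    (λ s≗s' indep s'-inj →
       RowsIndep-cong (indep (λ sx≡sy → s'-inj (≡.trans (≡.sym (s≗s' _)) (≡.trans sx≡sy (s≗s' _)))))
                      (λ l i → reflexive (≡.cong (G i) (s≗s' l))))
    (λ s → injective? s →-dec RowsIndep? (λ l i → G i (s l)))

  IsGenC? : ∀ t n m (G : Mat m n) → Dec (IsGenC t n m G)
  IsGenC? t n m G = RowsIndep? G ×-dec TColsIndep? t G

  -- Non-isolation is only a double negation of an existential; finiteness of the field
  -- makes that existential decidable, which yields an actual subcode.
  nonIsolated⇒subcode : ∀ {t n k} {C : Mat (suc k) n} → ¬ Isolated t n (suc k) C →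
                        Σ (Mat k n) λ D → IsGenC t n k D × D ⊆ C
  nonIsolated⇒subcode {t} {n} {k} {C} ¬isolated =
    let D , D-gen , D-rows = decidable-stable subcode?
                               (λ ¬∃ → ¬isolated λ (D , D-gen , D⊆C) → ¬∃ (D , D-gen , λ r → D⊆C _ (span-row D r)))
    in D , D-gen , rows⇒⊆ D-rows
    where
    subcode? : Dec (Σ (Mat k n) λ D → IsGenC t n k D × ∀ r → InSpan C (D r))
    subcode? = search matrices-searchable _
      (λ D≈D' (D-gen , D-rows) → IsGenC-cong D-gen D≈D' , λ r → span-cong C (D-rows r) (D≈D' r))
      (λ D → IsGenC? t n k D ×-dec all? (λ r → span? C (D r)))

  ∃-∉-span₂ : ∀ {k n} → k < n → (A B : Mat k n) → ∃ λ y → ¬ InSpan A y × ¬ InSpan B y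
  ∃-∉-span₂ k<n A B with ∃-∉-span k<n A | ∃-∉-span k<n B
  ... | y₁ , y₁∉A | y₂ , y₂∉B with span? B y₁ | span? A y₂
  ... | no y₁∉B  | _         = y₁ , y₁∉A , y₁∉B
  ... | yes _    | no y₂∉A   = y₂ , y₂∉A , y₂∉B
  ... | yes y₁∈B | yes y₂∈A  = (λ j → y₁ j + y₂ j) ,
    (λ y∈A → y₁∉A (span-cong A (span-- A y∈A y₂∈A) (λ j → //-rightDividesʳ (y₂ j) (y₁ j)))) ,
    (λ y∈B → y₂∉B (span-cong B (span-- B y∈B y₁∈B)
                     (λ j → trans (+-congʳ (+-comm _ _)) (//-rightDividesʳ (y₁ j) (y₂ j)))))

  module Component {t n k} (k<n : suc k < n) (C' : Vertex t n (suc k)) where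
    _⟶*_ : Vertex t n (suc k) → Vertex t n (suc k) → Set (c ⊔ ℓ)
    _⟶*_ = Star (Adjacent t n (suc k))

    connected-over : ∀ {D : Mat k n} (X Y : Vertex t n (suc k)) →
                     IsGenC t n k D → D ⊆ proj₁ X → D ⊆ proj₁ Y → X ⟶* Y
    connected-over {D} X Y D-gen D⊆X D⊆Y with ∃-∉-span₂ k<n (proj₁ X) (proj₁ Y)
    ... | y , y∉X , y∉Y =
      _◅_ {j = Z} (adjacent-∷ X D-gen D⊆X y∉X (proj₂ Z))
                  (adjacent-sym {X = Y} {Y = Z} (adjacent-∷ Y D-gen D⊆Y y∉Y (proj₂ Z)) ◅ ε)
      where
      Z : Vertex t n (suc k)
      Z = y ∷ D , ∷-IsGenC D-gen (y∉X ∘ ⊆⇒span D⊆X)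

    Anchored : Mat k n → Set (c ⊔ ℓ)
    Anchored E = IsGenC t n k E × (∀ V → E ⊆ proj₁ V → V ⟶* C')

    common-vertex : ∀ {E₁ E₂ : Mat k n} {w} → IsGenC t n k E₁ → E₂ ⊆ w ∷ E₁ →
                    Σ (Vertex t n (suc k)) λ X → E₁ ⊆ proj₁ X × E₂ ⊆ proj₁ X
    common-vertex {E₁} {E₂} {w} E₁-gen E₂⊆wE₁ with span? E₁ w
    ... | no w∉E₁  = (w ∷ E₁ , ∷-IsGenC E₁-gen w∉E₁) , ⊆-∷ , E₂⊆wE₁
    ... | yes w∈E₁ = let y , y∉E₁ = ∃-∉-span (<⇒≤ k<n) E₁ in
      (y ∷ E₁ , ∷-IsGenC E₁-gen y∉E₁) , ⊆-∷ , ⊆-trans E₂⊆wE₁ (⊆-trans (∷-⊆ w∈E₁ (mk⊆ id)) ⊆-∷)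

    anchored-step : ∀ {E₁ E₂ : Mat k n} {w} → Anchored E₁ → IsGenC t n k E₂ → E₂ ⊆ w ∷ E₁ → Anchored E₂
    anchored-step (E₁-gen , E₁-reach) E₂-gen E₂⊆wE₁ = E₂-gen , λ V E₂⊆V →
      let X , E₁⊆X , E₂⊆X = common-vertex E₁-gen E₂⊆wE₁
      in connected-over V X E₂-gen E₂⊆V E₂⊆X ◅◅ E₁-reach X E₁⊆X

    anchored-cong : ∀ {E E' : Mat k n} → Anchored E → (∀ r j → E r j ≈ E' r j) → Anchored E'
    anchored-cong {E' = E'} (E-gen , E-reach) E≈E' = IsGenC-cong E-gen E≈E' , λ V E'⊆V →
      E-reach V (⊆-trans (rows⇒⊆ λ r → span-cong E' (span-row E' r) (sym ∘ E≈E' r)) E'⊆V)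

    anchored-transpose : ∀ {E : Mat k n} (a b : Fin n) → Anchored E → Anchored (λ r j → E r (PC.transpose a b j))
    anchored-transpose {E} a b E-anch =
      anchored-step E-anch (IsGenC-permute (proj₁ E-anch) (Perm.transpose a b)) (⊆-∷-transpose E a b)

    anchored-eval : ∀ {E : Mat k n} → Anchored E → (xs : TranspositionList n) →
                    Anchored (λ r j → E r (eval xs ⟨$⟩ʳ j))
    anchored-eval E-anch List.[]               = E-anch
    anchored-eval E-anch ((a , b) List.∷ xs) = anchored-transpose a b (anchored-eval E-anch xs)

    anchored-permute : ∀ {E : Mat k n} → Anchored E → (π : Permutation′ n) → Anchored (λ r j → E r (π ⟨$⟩ʳ j))
    anchored-permute {E} E-anch π =
      anchored-cong (anchored-eval E-anch (decompose π)) (λ r j → reflexive (≡.cong (E r) (eval-decompose π j)))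

    anchored-scale : ∀ {D : Mat k n} {μ : Fin n → Carrier} → (∀ j → ¬ μ j ≈ 0#) →
                     Anchored D → Anchored (λ r j → μ j * D r j)
    anchored-scale {D} {μ} μ≉0 D-anch =
      anchored-cong (scaled n ≤-refl) (λ r j → *-congʳ (reflexive (prefixOr-all 1# μ j)))
      where
      S : ℕ → Mat k n
      S m r j = prefixOr 1# m μ j * D r j
      scaled : ∀ m → m ≤ n → Anchored (S m)
      scaled zero    _   = anchored-cong D-anch
        (λ r j → sym (trans (*-congʳ (reflexive (prefixOr-zero 1# μ j))) (*-identityˡ _)))
      scaled (suc m) m<n = anchored-step (scaled m (<⇒≤ m<n))
        (IsGenC-scale (prefixOr-preserves (λ x → ¬ x ≈ 0#) 1≉0 μ≉0 (suc m)) (proj₁ D-anch))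
        (⊆-∷-δ (fromℕ< m<n) (λ r j j≢m → *-congʳ (reflexive (prefixOr-suc 1# m<n μ j≢m))))

    -- monomial σ λs scales the columns by λs and then reads them through σ⁻¹ = flip σ.
    anchored-monomial : ∀ {D : Mat k n} → Anchored D → (σ : Permutation′ n) (λs : Fin n → Carrier) →
                        (∀ j → ¬ λs j ≈ 0#) → Anchored (λ r → monomial σ λs (D r))
    anchored-monomial D-anch σ λs λs≉0 = anchored-permute (anchored-scale λs≉0 D-anch) (Perm.flip σ)

    anchored-subcode : ∀ {D : Mat k n} → IsGenC t n k D → D ⊆ proj₁ C' → Anchored D
    anchored-subcode D-gen D⊆C' = D-gen , λ V D⊆V → connected-over V C' D-gen D⊆V D⊆C'

corollary3p6 : ∀ {c ℓ} (R : CommutativeRing c ℓ) (q : ℕ) → IsFiniteField R q →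
    (n k t : ℕ) → 0 < k → k < n → t ≤ k →
    (C C' : Codes.Vertex R t n k) →
    ¬ Codes.Isolated R t n k (proj₁ C) → ¬ Codes.Isolated R t n k (proj₁ C') →
    Codes.Equivalent R (proj₁ C) (proj₁ C') →
    Codes.SameComponent R t n k C C'
corollary3p6 R q F n zero t ()
corollary3p6 R q F n (suc k) t _ k<n _ C C' _ C'-not-isolated (σ , λs , λs≉0 , C≈ρC') =
  C' , C⟶*C' (nonIsolated⇒subcode C'-not-isolated) , λ _ → id , id
  where
  open Codes R
  open RowSpaces R
  open FiniteFieldCodes R F
  open Component k<n C'
  C⟶*C' : (Σ (Mat k n) λ D → IsGenC t n k D × D ⊆ proj₁ C') → C ⟶* C'
  C⟶*C' (D , D-gen , D⊆C') =
    proj₂ (anchored-monomial (anchored-subcode D-gen D⊆C') σ λs λs≉0) C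
          (⊆-trans (⊆-monomial σ λs D⊆C') (mk⊆ λ {v} → proj₂ (C≈ρC' v)))
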